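{- Let $\mathcal{A}$ be an $N$-colored Adinkra with $N\geq 3$, and let $uv$ be an edge of $\mathcal{A}$ of sign $\epsilon\in\{\pm1\}$. Then $\langle [{\bf e}_u-\epsilon {\bf e}_v], [{\bf e}_u-\epsilon {\bf e}_v]\rangle=\frac{2}{N}$ in $\mathbb{Q}/\mathbb{Z}$, and this is nonzero in $\mathbb{Q}/\mathbb{Z}$. Moreover, if $xy$ is another edge of $\mathcal{A}$ (distinct from $uv$) of the same color as $uv$ and of sign $\epsilon'\in\{\pm1\}$, then $\langle [{\bf e}_u-\epsilon {\bf e}_v], [{\bf e}_x-\epsilon' {\bf e}_y]\rangle=0$ in $\mathbb{Q}/\mathbb{Z}$.
   Context: Graphs are finite, simple, connected. A signed graph is a graph with a map $\sigma$ from edges to $\{\pm\}$ (identified with $\{\pm1\}$). For $N\geq 2$, an $N$-colored Adinkra is a signed graph whose edges are each colored by one of $N$ colors such that: (1) the graph is bipartite; (2) every vertex is incident to exactly one edge of each color; (3) for every pair of distinct colors, the subgraph formed by the edges of these two colors is a disjoint union of $4$-cycles; (4) each such bi-colored $4$-cycle contains an odd number of negative edges. Its Laplacian is $L(\mathcal{A})=D-A_\sigma$, with $D$ the diagonal degree matrix and $A_\sigma$ the signed adjacency matrix ($\pm1$ for positive/negative edges, $0$ otherwise); the critical group $\mathcal{K}(\mathcal{A})$ is the (finite) cokernel of $L(\mathcal{A})$ on $\mathbb{Z}^{V}$, $V$ the vertex set, with standard basis $\{{\bf e}_w:w\in V\}$. The monodromy pairing $\langle\cdot,\cdot\rangle:\mathcal{K}(\mathcal{A})\times\mathcal{K}(\mathcal{A})\to\mathbb{Q}/\mathbb{Z}$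 is defined as follows: for ${\bf x},{\bf y}\in\mathbb{Z}^V$, choose a positive integer $m$ and ${\bf f}\in\mathbb{Z}^V$ with $L(\mathcal{A}){\bf f}=m{\bf x}$, and set $\langle[{\bf x}],[{\bf y}]\rangle={\bf f}^T{\bf y}/m \bmod \mathbb{Z}$; this is well-defined, bilinear and symmetric. -}

module Defs where

open import Data.Nat using (ℕ; zero; suc; NonZero)
open import Data.Fin using (Fin; zero; suc; _≟_)
open import Data.Bool using (Bool; true; false; if_then_else_)
open import Data.Integer as ℤ using (ℤ; +_; _◃_)
open import Data.Sign as Sign using (Sign)
open import Data.Rational as ℚ using (ℚ)
open import Data.Product using (Σ; ∃; _×_; _,_)
open import Data.Sum using (_⊎_)
open import Relation.Nullary using (¬_; does)
open import Relation.Binary.PropositionalEquality using (_≡_; _≢_)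

∑ : ∀ {n} → (Fin n → ℤ) → ℤ
∑ {zero}  f = + 0
∑ {suc n} f = f zero ℤ.+ ∑ (λ i → f (suc i))

data Reach {n : ℕ} (adj : Fin n → Fin n → Bool) : Fin n → Fin n → Set where
  here : ∀ {w} → Reach adj w w
  step : ∀ {w z t} → adj w z ≡ true → Reach adj z t → Reach adj w t

-- The (simple, undirected) graph is given by a symmetric irreflexive adjacency
-- relation; colour and sign are only meaningful on edges (adj w z ≡ true).
record Adinkra (N : ℕ) : Set where
  field
    n         : ℕ
    adj       : Fin n → Fin n → Bool
    adj-sym   : ∀ w z → adj w z ≡ adj z w
    adj-irr   : ∀ w → adj w w ≡ false
    color     : Fin n → Fin n → Fin N
    color-sym : ∀ w z → adj w z ≡ true → color w z ≡ color z w
    sign      : Fin n → Fin n → Sign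
    sign-sym  : ∀ w z → adj w z ≡ true → sign w z ≡ sign z w
    connected : ∀ w z → Reach adj w z
    bipartite : ∃ λ (part : Fin n → Bool) → ∀ w z → adj w z ≡ true → part w ≢ part z
    colour-exists : ∀ w (c : Fin N) → ∃ λ z → adj w z ≡ true × color w z ≡ c
    colour-unique : ∀ w z z' → adj w z ≡ true → adj w z' ≡ true →
                    color w z ≡ color w z' → z ≡ z'
    -- (3) for distinct colours c, d the c/d-coloured edges form a disjoint union
    -- of 4-cycles: the c-d-path  w –c– a –d– b  closes up with the d-edge w –d– z
    -- via a c-edge  z –c– b.
    -- (4) each such bicoloured 4-cycle has an odd number of negative edges,
    -- i.e. the product of its four signs is negative.
    four-cycles : ∀ (c d : Fin N) → c ≢ d → ∀ w a b z →
                  adj w a ≡ true → color w a ≡ c →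
                  adj a b ≡ true → color a b ≡ d →
                  adj w z ≡ true → color w z ≡ d →
                  (adj z b ≡ true × color z b ≡ c) ×
                  (sign w a Sign.* sign a b Sign.* sign b z Sign.* sign z w ≡ Sign.-)

-- q is an integer, i.e. q ≡ 0 in ℚ/ℤ
IsIntegral : ℚ → Set
IsIntegral q = ∃ λ (k : ℤ) → q ≡ k ℚ./ 1

module _ {N : ℕ} (𝒜 : Adinkra N) where
  open Adinkra 𝒜

  Vertex : Set
  Vertex = Fin n

  ZV : Set
  ZV = Vertex → ℤ

  e : Vertex → ZV
  e w t = if does (w ≟ t) then + 1 else + 0

  Aσ : Vertex → Vertex → ℤ
  Aσ w z = if adj w z then sign w z ◃ 1 else + 0

  deg : Vertex → ℤ
  deg w = ∑ (λ z → if adj w z then + 1 else + 0)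

  Lap : Vertex → Vertex → ℤ
  Lap w z = (if does (w ≟ z) then deg w else + 0) ℤ.- Aσ w z

  L· : ZV → ZV
  L· f w = ∑ (λ z → Lap w z ℤ.* f z)

  _·_ : ZV → ZV → ℤ
  f · g = ∑ (λ w → f w ℤ.* g w)

  -- Monodromy pairing ⟨[x],[y]⟩ equals q in ℚ/ℤ:
  -- for some positive integer m = suc k and f with L f = m x,
  -- f^T y / m ≡ q  (mod ℤ).
  PairingEq : ZV → ZV → ℚ → Set
  PairingEq x y q =
    ∃ λ (k : ℕ) → ∃ λ (f : ZV) →
      (∀ w → L· f w ≡ (+ suc k) ℤ.* x w) ×
      IsIntegral (((f · y) ℚ./ suc k) ℚ.- q)

  edgeVec : Vertex → Vertex → ZV
  edgeVec u v t = e u t ℤ.- (sign u v ◃ 1) ℤ.* e v t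

{-# OPTIONS --safe #-}
-- The signed adjacency matrix A of an Adinkra satisfies A² = N·I. A diagonal entry counts the N
-- neighbours of a vertex; off the diagonal, the common neighbours z of two vertices w ≠ t come in
-- pairs z, z′ spanning a bicoloured square w z t z′, whose odd sign makes A_wz A_zt and A_wz′ A_z′t
-- cancel. Since every vertex has degree N, L = N·I − A and so L (N·I + A) = N(N − 1)·I: the pairing
-- is computed with f = (N·I + A) x and m = N(N − 1). For x = e_u − ε e_v this gives fᵀx = 2N − 2,
-- that is 2/N. If xy is another edge of the colour of uv, then x is adjacent to u exactly when y is
-- adjacent to v, the four vertices spanning a bicoloured square, and its odd sign makes the terms of
-- fᵀ(e_x − ε′ e_y) cancel in pairs (likewise for x, v and y, u).
module Submission where

open import Defs
open import Data.Nat as ℕ using (ℕ; zero; suc; NonZero; _≤_; s≤s)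
open import Data.Fin using (Fin; zero; suc; _≟_)
open import Data.Fin.Permutation using (permutation)
open import Data.Bool as Bool using (Bool; true; false; if_then_else_)
open import Data.Bool.Properties using (¬-not; not-¬)
open import Data.Integer as ℤ using (ℤ; +_; -[1+_]; _+_; _*_; -_; _-_; _◃_; -1ℤ)
import Data.Integer.Properties as ℤP
open import Data.Integer.Tactic.RingSolver using (solve-∀)
open import Data.Sign as Sign using (Sign)
open import Data.Rational as ℚ using (_/_; 0ℚ)
import Data.Rational.Properties as ℚP
open import Data.Rational.Unnormalised using (mkℚᵘ; *≡*)
open import Data.Product using (_×_; _,_; proj₁; proj₂)
open import Data.Sum using (_⊎_; inj₁; inj₂)
open import Data.Empty using (⊥-elim)
open import Relation.Nullary using (¬_; does; yes; no)
open import Relation.Binary.PropositionalEquality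
open import Algebra.Properties.Semiring.Sum ℤP.+-*-semiring
  using (sum; ∑-distrib-+; ∑-comm; ∑-permute; *-distribˡ-sum; *-distribʳ-sum; sum-cong-≗; sum-replicate-zero)

open ≡-Reasoning

private
  variable
    m : ℕ

∑≡sum : (f : Fin m → ℤ) → ∑ f ≡ sum f
∑≡sum {zero}  f = refl
∑≡sum {suc m} f = cong (_+_ (f zero)) (∑≡sum (λ i → f (suc i)))

sum-lincomb : ∀ a b (f g : Fin m → ℤ) → sum (λ i → a * f i + b * g i) ≡ a * sum f + b * sum g
sum-lincomb a b f g =
  trans (∑-distrib-+ (λ i → a * f i) (λ i → b * g i))
        (sym (cong₂ _+_ (*-distribˡ-sum a f) (*-distribˡ-sum b g)))

sum-neg : (f : Fin m → ℤ) → sum (λ i → - f i) ≡ - sum f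
sum-neg f = begin
  sum (λ i → - f i)      ≡⟨ sum-cong-≗ (λ i → sym (ℤP.-1*i≡-i (f i))) ⟩
  sum (λ i → -1ℤ * f i)  ≡⟨ *-distribˡ-sum -1ℤ f ⟨
  -1ℤ * sum f            ≡⟨ ℤP.-1*i≡-i (sum f) ⟩
  - sum f                ∎

x≡-x⇒x≡0 : ∀ x → x ≡ - x → x ≡ + 0
x≡-x⇒x≡0 (+ zero)  _  = refl
x≡-x⇒x≡0 (+ suc _) ()
x≡-x⇒x≡0 -[1+ _ ]  ()

sum-odd-involution : (π : Fin m → Fin m) → (∀ i → π (π i) ≡ i) →
                     (f : Fin m → ℤ) → (∀ i → f (π i) ≡ - f i) → sum f ≡ + 0
sum-odd-involution π π-involutive f f-odd = x≡-x⇒x≡0 (sum f) (begin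
  sum f              ≡⟨ ∑-permute f (permutation π π π-involutive π-involutive) ⟩
  sum (λ i → f (π i)) ≡⟨ sum-cong-≗ f-odd ⟩
  sum (λ i → - f i)  ≡⟨ sum-neg f ⟩
  - sum f            ∎)

sum-ones : sum {m} (λ _ → + 1) ≡ + m
sum-ones {zero}  = refl
sum-ones {suc m} = cong (_+_ (+ 1)) (sum-ones {m})

𝟙 : Bool → ℤ
𝟙 b = if b then + 1 else + 0

δ : Fin m → Fin m → ℤ
δ w t = 𝟙 (does (w ≟ t))

δ-≢ : {w t : Fin m} → ¬ w ≡ t → δ w t ≡ + 0
δ-≢ {w = w} {t} w≢t with w ≟ t
... | yes w≡t = ⊥-elim (w≢t w≡t)
... | no  _   = refl

δ-refl : (w : Fin m) → δ w w ≡ + 1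
δ-refl w with w ≟ w
... | yes _ = refl
... | no  w≢w = ⊥-elim (w≢w refl)

sum-δˡ : (w : Fin m) (g : Fin m → ℤ) → sum (λ z → δ w z * g z) ≡ g w
sum-δˡ {suc m} zero g =
  trans (cong (_+_ (+ 1 * g zero)) (sum-replicate-zero m))
        (trans (ℤP.+-identityʳ _) (ℤP.*-identityˡ _))
sum-δˡ {suc m} (suc w) g = trans (ℤP.+-identityˡ _) (sum-δˡ w (λ i → g (suc i)))

sum-δʳ : (w : Fin m) (g : Fin m → ℤ) → sum (λ z → g z * δ w z) ≡ g w
sum-δʳ w g = trans (sum-cong-≗ (λ z → ℤP.*-comm (g z) (δ w z))) (sum-δˡ w g)

sum-*-δ-difference : (g : Fin m → ℤ) (p q : Fin m) (s : ℤ) →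
                     sum (λ z → g z * (δ p z - s * δ q z)) ≡ g p - s * g q
sum-*-δ-difference g p q s = begin
  sum (λ z → g z * (δ p z - s * δ q z))
    ≡⟨ sum-cong-≗ (λ z → expand (g z) (δ p z) s (δ q z)) ⟩
  sum (λ z → + 1 * (g z * δ p z) + - s * (g z * δ q z))
    ≡⟨ sum-lincomb (+ 1) (- s) (λ z → g z * δ p z) (λ z → g z * δ q z) ⟩
  + 1 * sum (λ z → g z * δ p z) + - s * sum (λ z → g z * δ q z)
    ≡⟨ cong₂ (λ x y → + 1 * x + - s * y) (sum-δʳ p g) (sum-δʳ q g) ⟩
  + 1 * g p + - s * g q
    ≡⟨ collect (g p) (g q) s ⟩
  g p - s * g q ∎
  where
  expand : ∀ x y s y′ → x * (y - s * y′) ≡ + 1 * (x * y) + - s * (x * y′)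
  expand = solve-∀
  collect : ∀ x y s → + 1 * x + - s * y ≡ x - s * y
  collect = solve-∀

Matrix : ℕ → Set
Matrix m = Fin m → Fin m → ℤ

_*ᵥ_ : Matrix m → (Fin m → ℤ) → (Fin m → ℤ)
(M *ᵥ x) w = sum (λ z → M w z * x z)

_*ₘ_ : Matrix m → Matrix m → Matrix m
(M *ₘ M′) w t = sum (λ z → M w z * M′ z t)

*ᵥ-*ᵥ : (M M′ : Matrix m) (x : Fin m → ℤ) (w : Fin m) →
        (M *ᵥ (M′ *ᵥ x)) w ≡ ((M *ₘ M′) *ᵥ x) w
*ᵥ-*ᵥ M M′ x w = begin
  sum (λ z → M w z * sum (λ y → M′ z y * x y))
    ≡⟨ sum-cong-≗ (λ z → *-distribˡ-sum (M w z) (λ y → M′ z y * x y)) ⟩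
  sum (λ z → sum (λ y → M w z * (M′ z y * x y)))
    ≡⟨ ∑-comm (λ z y → M w z * (M′ z y * x y)) ⟩
  sum (λ y → sum (λ z → M w z * (M′ z y * x y)))
    ≡⟨ sum-cong-≗ (λ y → trans (sum-cong-≗ (λ z → sym (ℤP.*-assoc (M w z) (M′ z y) (x y))))
                                (sym (*-distribʳ-sum (x y) (λ z → M w z * M′ z y)))) ⟩
  sum (λ y → sum (λ z → M w z * M′ z y) * x y) ∎

*ᵥ-scalar : (M : Matrix m) (a : ℤ) → (∀ w t → M w t ≡ a * δ w t) →
            (x : Fin m → ℤ) (w : Fin m) → (M *ᵥ x) w ≡ a * x w
*ᵥ-scalar M a M≡aI x w = begin
  sum (λ z → M w z * x z)       ≡⟨ sum-cong-≗ (λ z → trans (cong (_* x z) (M≡aI w z)) (ℤP.*-assoc a (δ w z) (x z))) ⟩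
  sum (λ z → a * (δ w z * x z)) ≡⟨ *-distribˡ-sum a (λ z → δ w z * x z) ⟨
  a * sum (λ z → δ w z * x z)   ≡⟨ cong (a *_) (sum-δˡ w x) ⟩
  a * x w                       ∎

*ᵥ-lincomb : (M : Matrix m) (a b : ℤ) (x y : Fin m → ℤ) (w : Fin m) →
             (M *ᵥ (λ z → a * x z + b * y z)) w ≡ a * (M *ᵥ x) w + b * (M *ᵥ y) w
*ᵥ-lincomb M a b x y w =
  trans (sum-cong-≗ (λ z → distribute (M w z) a (x z) b (y z)))
        (sum-lincomb a b (λ z → M w z * x z) (λ z → M w z * y z))
  where
  distribute : ∀ m a x b y → m * (a * x + b * y) ≡ a * (m * x) + b * (m * y)
  distribute = solve-∀

scalar-minus-*ᵥ : (c : ℤ) (M : Matrix m) (g : Fin m → ℤ) (w : Fin m) →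
                  ((λ w z → c * δ w z - M w z) *ᵥ g) w ≡ c * g w - (M *ᵥ g) w
scalar-minus-*ᵥ c M g w = begin
  sum (λ z → (c * δ w z - M w z) * g z)
    ≡⟨ sum-cong-≗ (λ z → distribute c (δ w z) (M w z) (g z)) ⟩
  sum (λ z → c * (δ w z * g z) + -1ℤ * (M w z * g z))
    ≡⟨ sum-lincomb c -1ℤ (λ z → δ w z * g z) (λ z → M w z * g z) ⟩
  c * sum (λ z → δ w z * g z) + -1ℤ * (M *ᵥ g) w
    ≡⟨ cong (λ s → c * s + -1ℤ * (M *ᵥ g) w) (sum-δˡ w g) ⟩
  c * g w + -1ℤ * (M *ᵥ g) w
    ≡⟨ collect (c * g w) ((M *ᵥ g) w) ⟩
  c * g w - (M *ᵥ g) w ∎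
  where
  distribute : ∀ c d m y → (c * d - m) * y ≡ c * (d * y) + -1ℤ * (m * y)
  distribute = solve-∀
  collect : ∀ x y → x + -1ℤ * y ≡ x - y
  collect = solve-∀

scalar-minus-*ᵥ-scalar-plus : (A : Matrix m) (a c : ℤ) → (∀ w t → (A *ₘ A) w t ≡ a * δ w t) →
  (x : Fin m → ℤ) (w : Fin m) →
  ((λ w z → c * δ w z - A w z) *ᵥ (λ z → c * x z + (A *ᵥ x) z)) w ≡ (c * c - a) * x w
scalar-minus-*ᵥ-scalar-plus A a c A²≡aI x w = begin
  ((λ w z → c * δ w z - A w z) *ᵥ g) w
    ≡⟨ scalar-minus-*ᵥ c A g w ⟩
  c * g w - (A *ᵥ g) w
    ≡⟨ cong (λ s → c * g w - s) (trans (sum-cong-≗ (λ z → cong (λ y → A w z * (c * x z + y)) (sym (ℤP.*-identityˡ _))))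
                                        (*ᵥ-lincomb A c (+ 1) x (A *ᵥ x) w)) ⟩
  c * g w - (c * (A *ᵥ x) w + + 1 * (A *ᵥ (A *ᵥ x)) w)
    ≡⟨ cong (λ s → c * g w - (c * (A *ᵥ x) w + + 1 * s)) (trans (*ᵥ-*ᵥ A A x w) (*ᵥ-scalar (A *ₘ A) a A²≡aI x w)) ⟩
  c * (c * x w + (A *ᵥ x) w) - (c * (A *ᵥ x) w + + 1 * (a * x w))
    ≡⟨ cancel a c (x w) ((A *ᵥ x) w) ⟩
  (c * c - a) * x w ∎
  where
  g : Fin _ → ℤ
  g z = c * x z + (A *ᵥ x) z
  cancel : ∀ a c x y → c * (c * x + y) - (c * y + + 1 * (a * x)) ≡ (c * c - a) * x
  cancel = solve-∀

⟦_⟧ : Sign → ℤ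
⟦ s ⟧ = s ◃ 1

⟦⟧-square : ∀ s → ⟦ s ⟧ * ⟦ s ⟧ ≡ + 1
⟦⟧-square Sign.+ = refl
⟦⟧-square Sign.- = refl

⟦⟧-*-⟦⟧ : ∀ s x → ⟦ s ⟧ * (⟦ s ⟧ * x) ≡ x
⟦⟧-*-⟦⟧ s x = begin
  ⟦ s ⟧ * (⟦ s ⟧ * x) ≡⟨ ℤP.*-assoc ⟦ s ⟧ ⟦ s ⟧ x ⟨
  ⟦ s ⟧ * ⟦ s ⟧ * x   ≡⟨ cong (_* x) (⟦⟧-square s) ⟩
  + 1 * x             ≡⟨ ℤP.*-identityˡ x ⟩
  x                   ∎

four-cycle-⟦⟧ : ∀ a b c d → a Sign.* b Sign.* c Sign.* d ≡ Sign.- → ⟦ a ⟧ * ⟦ b ⟧ ≡ - (⟦ c ⟧ * ⟦ d ⟧)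
four-cycle-⟦⟧ Sign.+ Sign.+ Sign.+ Sign.+ ()
four-cycle-⟦⟧ Sign.+ Sign.+ Sign.+ Sign.- _  = refl
four-cycle-⟦⟧ Sign.+ Sign.+ Sign.- Sign.+ _  = refl
four-cycle-⟦⟧ Sign.+ Sign.+ Sign.- Sign.- ()
four-cycle-⟦⟧ Sign.+ Sign.- Sign.+ Sign.+ _  = refl
four-cycle-⟦⟧ Sign.+ Sign.- Sign.+ Sign.- ()
four-cycle-⟦⟧ Sign.+ Sign.- Sign.- Sign.+ ()
four-cycle-⟦⟧ Sign.+ Sign.- Sign.- Sign.- _  = refl
four-cycle-⟦⟧ Sign.- Sign.+ Sign.+ Sign.+ _  = refl
four-cycle-⟦⟧ Sign.- Sign.+ Sign.+ Sign.- ()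
four-cycle-⟦⟧ Sign.- Sign.+ Sign.- Sign.+ ()
four-cycle-⟦⟧ Sign.- Sign.+ Sign.- Sign.- _  = refl
four-cycle-⟦⟧ Sign.- Sign.- Sign.+ Sign.+ ()
four-cycle-⟦⟧ Sign.- Sign.- Sign.+ Sign.- _  = refl
four-cycle-⟦⟧ Sign.- Sign.- Sign.- Sign.+ _  = refl
four-cycle-⟦⟧ Sign.- Sign.- Sign.- Sign.- ()

cross-terms-cancel : ∀ ε ε′ a b c d → ε * ε ≡ + 1 → ε * a ≡ - (ε′ * d) → ε * b ≡ - (ε′ * c) →
                     (a - ε * b) - ε′ * (c - ε * d) ≡ + 0
cross-terms-cancel ε ε′ a b c d ε²≡1 εa εb = begin
  (a - ε * b) - ε′ * (c - ε * d)
    ≡⟨ expand ε ε′ a b c d ⟩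
  ε * (ε * a) + ε′ * (ε * d) - ε * b - ε′ * c + (+ 1 - ε * ε) * a
    ≡⟨ cong₂ (λ x y → ε * x + ε′ * (ε * d) - y - ε′ * c + (+ 1 - ε * ε) * a) εa εb ⟩
  ε * - (ε′ * d) + ε′ * (ε * d) - - (ε′ * c) - ε′ * c + (+ 1 - ε * ε) * a
    ≡⟨ cong (λ s → ε * - (ε′ * d) + ε′ * (ε * d) - - (ε′ * c) - ε′ * c + (+ 1 - s) * a) ε²≡1 ⟩
  ε * - (ε′ * d) + ε′ * (ε * d) - - (ε′ * c) - ε′ * c + (+ 1 - + 1) * a
    ≡⟨ cancel ε ε′ a c d ⟩
  + 0 ∎
  where
  expand : ∀ ε ε′ a b c d →
           (a - ε * b) - ε′ * (c - ε * d) ≡ ε * (ε * a) + ε′ * (ε * d) - ε * b - ε′ * c + (+ 1 - ε * ε) * a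
  expand = solve-∀
  cancel : ∀ ε ε′ a c d → ε * - (ε′ * d) + ε′ * (ε * d) - - (ε′ * c) - ε′ * c + (+ 1 - + 1) * a ≡ + 0
  cancel = solve-∀

module _ {N : ℕ} (𝒜 : Adinkra N) where
  open Adinkra 𝒜

  private
    A : Matrix n
    A = Aσ 𝒜

  adj-flip : ∀ {w z} → adj w z ≡ true → adj z w ≡ true
  adj-flip {w} {z} wz = trans (adj-sym z w) wz

  Aσ-edge : ∀ {w z} → adj w z ≡ true → A w z ≡ ⟦ sign w z ⟧
  Aσ-edge wz rewrite wz = refl

  Aσ-nonedge : ∀ {w z} → adj w z ≡ false → A w z ≡ + 0
  Aσ-nonedge wz rewrite wz = refl

  Aσ-edge-flip : ∀ {w z} → adj w z ≡ true → A z w ≡ ⟦ sign w z ⟧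
  Aσ-edge-flip {w} {z} wz = trans (Aσ-edge (adj-flip wz)) (cong ⟦_⟧ (sym (sign-sym w z wz)))

  Aσ-*-transpose : ∀ w z → A w z * A z w ≡ 𝟙 (adj w z)
  Aσ-*-transpose w z with adj w z in wz
  ... | true  = trans (cong (_*_ ⟦ sign w z ⟧) (Aσ-edge-flip wz)) (⟦⟧-square (sign w z))
  ... | false = refl

  neighbour : Fin n → Fin N → Fin n
  neighbour w c = proj₁ (colour-exists w c)

  neighbour-adj : ∀ w c → adj w (neighbour w c) ≡ true
  neighbour-adj w c = proj₁ (proj₂ (colour-exists w c))

  neighbour-color : ∀ w c → color w (neighbour w c) ≡ c
  neighbour-color w c = proj₂ (proj₂ (colour-exists w c))

  neighbour-color-of : ∀ {w z} → adj w z ≡ true → neighbour w (color w z) ≡ z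
  neighbour-color-of {w} {z} wz =
    colour-unique w _ z (neighbour-adj w (color w z)) wz (neighbour-color w (color w z))

  δ-colour-adj≡δ-neighbour : ∀ w c z → δ (color w z) c * 𝟙 (adj w z) ≡ δ (neighbour w c) z * + 1
  δ-colour-adj≡δ-neighbour w c z with adj w z in wz
  ... | false = trans (ℤP.*-zeroʳ (δ (color w z) c))
                  (sym (cong (_* + 1) (δ-≢ {w = neighbour w c} {t = z}
                    λ { refl → not-¬ (neighbour-adj w c) wz })))
  ... | true with color w z ≟ c
  ...   | yes refl = cong (_* + 1) (sym (trans (cong (λ y → δ y z) (neighbour-color-of wz)) (δ-refl z)))
  ...   | no  wz≢c = cong (_* + 1) (sym (δ-≢ {w = neighbour w c} {t = z}
                                           λ { refl → wz≢c (neighbour-color w c) }))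

  deg≡N : ∀ w → deg 𝒜 w ≡ + N
  deg≡N w = begin
    ∑ (λ z → 𝟙 (adj w z))
      ≡⟨ ∑≡sum (λ z → 𝟙 (adj w z)) ⟩
    sum (λ z → 𝟙 (adj w z))
      ≡⟨ sum-cong-≗ (λ z → sym (sum-δˡ (color w z) (λ _ → 𝟙 (adj w z)))) ⟩
    sum (λ z → sum (λ c → δ (color w z) c * 𝟙 (adj w z)))
      ≡⟨ ∑-comm (λ z c → δ (color w z) c * 𝟙 (adj w z)) ⟩
    sum (λ c → sum (λ z → δ (color w z) c * 𝟙 (adj w z)))
      ≡⟨ sum-cong-≗ (λ c → trans (sum-cong-≗ (δ-colour-adj≡δ-neighbour w c)) (sum-δˡ (neighbour w c) (λ _ → + 1))) ⟩
    sum {N} (λ _ → + 1)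
      ≡⟨ sum-ones ⟩
    + N ∎

  square-closes : ∀ {a b c d} → adj a b ≡ true → adj c d ≡ true → color c d ≡ color a b → ¬ a ≡ d →
                  adj c a ≡ true →
                  adj d b ≡ true × color d b ≡ color c a ×
                  ⟦ sign a b ⟧ * A c a ≡ - (⟦ sign c d ⟧ * A d b)
  square-closes {a} {b} {c} {d} ab cd cd∼ab a≢d ca = db , proj₂ (proj₁ square) , signs
    where
    colours-differ : ¬ color c a ≡ color a b
    colours-differ ca∼ab = a≢d (colour-unique c a d ca cd (trans ca∼ab (sym cd∼ab)))
    square = four-cycles (color c a) (color a b) colours-differ c a b d ca refl ab refl cd cd∼ab
    db : adj d b ≡ true
    db = proj₁ (proj₁ square)
    signs : ⟦ sign a b ⟧ * A c a ≡ - (⟦ sign c d ⟧ * A d b)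
    signs = begin
      ⟦ sign a b ⟧ * A c a           ≡⟨ cong (_*_ ⟦ sign a b ⟧) (Aσ-edge ca) ⟩
      ⟦ sign a b ⟧ * ⟦ sign c a ⟧    ≡⟨ ℤP.*-comm ⟦ sign a b ⟧ ⟦ sign c a ⟧ ⟩
      ⟦ sign c a ⟧ * ⟦ sign a b ⟧    ≡⟨ four-cycle-⟦⟧ (sign c a) (sign a b) (sign b d) (sign d c) (proj₂ square) ⟩
      - (⟦ sign b d ⟧ * ⟦ sign d c ⟧) ≡⟨ cong -_ (ℤP.*-comm ⟦ sign b d ⟧ ⟦ sign d c ⟧) ⟩
      - (⟦ sign d c ⟧ * ⟦ sign b d ⟧) ≡⟨ cong₂ (λ s t → - (⟦ s ⟧ * t)) (sign-sym d c (adj-flip cd)) (sym (Aσ-edge-flip (adj-flip db))) ⟩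
      - (⟦ sign c d ⟧ * A d b)       ∎

  same-colour-edges-Aσ : ∀ {a b c d} → adj a b ≡ true → adj c d ≡ true → color c d ≡ color a b →
                      ¬ a ≡ d → ¬ b ≡ c → ⟦ sign a b ⟧ * A c a ≡ - (⟦ sign c d ⟧ * A d b)
  same-colour-edges-Aσ {a} {b} {c} {d} ab cd cd∼ab a≢d b≢c with adj c a Bool.≟ true | adj d b Bool.≟ true
  ... | yes ca | _      = proj₂ (proj₂ (square-closes ab cd cd∼ab a≢d ca))
  ... | no ¬ca | yes db = ⊥-elim (¬ca (proj₁ (square-closes (adj-flip ab) (adj-flip cd) dc∼ba b≢c db)))
    where
    dc∼ba : color d c ≡ color b a
    dc∼ba = trans (sym (color-sym c d cd)) (trans cd∼ab (color-sym a b ab))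
  ... | no ¬ca | no ¬db = begin
    ⟦ sign a b ⟧ * A c a     ≡⟨ cong (_*_ ⟦ sign a b ⟧) (Aσ-nonedge (¬-not ¬ca)) ⟩
    ⟦ sign a b ⟧ * + 0       ≡⟨ ℤP.*-zeroʳ ⟦ sign a b ⟧ ⟩
    + 0                      ≡⟨ cong -_ (ℤP.*-zeroʳ ⟦ sign c d ⟧) ⟨
    - (⟦ sign c d ⟧ * + 0)   ≡⟨ cong (λ y → - (⟦ sign c d ⟧ * y)) (Aσ-nonedge (¬-not ¬db)) ⟨
    - (⟦ sign c d ⟧ * A d b) ∎

  module CommonNeighbours {w t : Fin n} (w≢t : ¬ w ≡ t) where

    path : Fin n → ℤ
    path z = A w z * A z t

    partner : Fin n → Fin n
    partner z = if adj w z then (if adj z t then neighbour w (color z t) else z) else z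

    partner-square : ∀ {z} → adj w z ≡ true → adj z t ≡ true →
                     let z′ = neighbour w (color z t) in
                     adj w z′ ≡ true × adj z′ t ≡ true × partner z′ ≡ z × path z′ ≡ - path z
    partner-square {z} wz zt = neighbour-adj w (color z t) , z′t , back , odd
      where
      z′ = neighbour w (color z t)
      z≢z′ : ¬ z ≡ z′
      z≢z′ z≡z′ = w≢t (colour-unique z w t (adj-flip wz) zt
                    (trans (sym (color-sym w z wz)) (trans (cong (color w) z≡z′) (neighbour-color w (color z t)))))
      closes = square-closes zt (neighbour-adj w (color z t)) (neighbour-color w (color z t)) z≢z′ wz
      z′t = proj₁ closes
      back : partner z′ ≡ z
      back rewrite neighbour-adj w (color z t) | z′t | proj₁ (proj₂ closes) = neighbour-color-of wz
      odd : path z′ ≡ - path z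
      odd = begin
        A w z′ * A z′ t          ≡⟨ cong (_* A z′ t) (Aσ-edge (neighbour-adj w (color z t))) ⟩
        ⟦ sign w z′ ⟧ * A z′ t   ≡⟨ ℤP.neg-involutive _ ⟨
        - - (⟦ sign w z′ ⟧ * A z′ t) ≡⟨ cong -_ (proj₂ (proj₂ closes)) ⟨
        - (⟦ sign z t ⟧ * A w z) ≡⟨ cong (λ y → - (y * A w z)) (Aσ-edge zt) ⟨
        - (A z t * A w z)        ≡⟨ cong -_ (ℤP.*-comm (A z t) (A w z)) ⟩
        - (A w z * A z t)        ∎

    partner-common : ∀ {z} → adj w z ≡ true → adj z t ≡ true → partner z ≡ neighbour w (color z t)
    partner-common wz zt rewrite wz | zt = refl

    partner-fixed : ∀ {z} → adj w z ≡ false ⊎ adj z t ≡ false → partner z ≡ z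
    partner-fixed (inj₁ wz) rewrite wz = refl
    partner-fixed {z} (inj₂ zt) rewrite zt with adj w z
    ... | true  = refl
    ... | false = refl

    path-vanishes : ∀ {z} → adj w z ≡ false ⊎ adj z t ≡ false → path z ≡ + 0
    path-vanishes {z} (inj₁ wz) = cong (_* A z t) (Aσ-nonedge wz)
    path-vanishes {z} (inj₂ zt) = trans (cong (_*_ (A w z)) (Aσ-nonedge zt)) (ℤP.*-zeroʳ (A w z))

    common-neighbour? : ∀ z → (adj w z ≡ true × adj z t ≡ true) ⊎ (adj w z ≡ false ⊎ adj z t ≡ false)
    common-neighbour? z with adj w z Bool.≟ true | adj z t Bool.≟ true
    ... | yes wz | yes zt = inj₁ (wz , zt)
    ... | yes _  | no ¬zt = inj₂ (inj₂ (¬-not ¬zt))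
    ... | no ¬wz | _      = inj₂ (inj₁ (¬-not ¬wz))

    partner-involutive : ∀ z → partner (partner z) ≡ z
    partner-involutive z with common-neighbour? z
    ... | inj₁ (wz , zt) = trans (cong partner (partner-common wz zt)) (proj₁ (proj₂ (proj₂ (partner-square wz zt))))
    ... | inj₂ lonely    = trans (cong partner (partner-fixed lonely)) (partner-fixed lonely)

    partner-odd : ∀ z → path (partner z) ≡ - path z
    partner-odd z with common-neighbour? z
    ... | inj₁ (wz , zt) = trans (cong path (partner-common wz zt)) (proj₂ (proj₂ (proj₂ (partner-square wz zt))))
    ... | inj₂ lonely    = trans (cong path (partner-fixed lonely))
                                 (trans (path-vanishes lonely) (cong -_ (sym (path-vanishes lonely))))

  Aσ-square : ∀ w t → (A *ₘ A) w t ≡ + N * δ w t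
  Aσ-square w t with w ≟ t
  ... | yes refl = begin
    sum (λ z → A w z * A z w) ≡⟨ sum-cong-≗ (Aσ-*-transpose w) ⟩
    sum (λ z → 𝟙 (adj w z))   ≡⟨ ∑≡sum (λ z → 𝟙 (adj w z)) ⟨
    deg 𝒜 w                   ≡⟨ deg≡N w ⟩
    + N                       ≡⟨ ℤP.*-identityʳ (+ N) ⟨
    + N * + 1                 ∎
  ... | no w≢t = trans (sum-odd-involution partner partner-involutive path partner-odd)
                       (sym (ℤP.*-zeroʳ (+ N)))
    where open CommonNeighbours w≢t

  Lap≡NI-Aσ : ∀ w z → Lap 𝒜 w z ≡ + N * δ w z - A w z
  Lap≡NI-Aσ w z with w ≟ z
  ... | yes refl = cong (_- A w w) (trans (deg≡N w) (sym (ℤP.*-identityʳ (+ N))))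
  ... | no  _    = cong (_- A w z) (sym (ℤP.*-zeroʳ (+ N)))

  NI+Aσ : ZV 𝒜 → ZV 𝒜
  NI+Aσ x w = + N * x w + (A *ᵥ x) w

  L·NI+Aσ : ∀ x w → L· 𝒜 (NI+Aσ x) w ≡ (+ N * + N - + N) * x w
  L·NI+Aσ x w = begin
    L· 𝒜 (NI+Aσ x) w
      ≡⟨ ∑≡sum (λ z → Lap 𝒜 w z * NI+Aσ x z) ⟩
    sum (λ z → Lap 𝒜 w z * NI+Aσ x z)
      ≡⟨ sum-cong-≗ (λ z → cong (_* NI+Aσ x z) (Lap≡NI-Aσ w z)) ⟩
    ((λ w z → + N * δ w z - A w z) *ᵥ NI+Aσ x) w
      ≡⟨ scalar-minus-*ᵥ-scalar-plus A (+ N) (+ N) Aσ-square x w ⟩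
    (+ N * + N - + N) * x w ∎

  pairing-via-NI+Aσ : ∀ k → + suc k ≡ + N * + N - + N → ∀ x y q {a} → _·_ 𝒜 (NI+Aσ x) y ≡ a →
                      IsIntegral ((a / suc k) ℚ.- q) → PairingEq 𝒜 x y q
  pairing-via-NI+Aσ k m≡N²-N x y q f·y≡a integral =
      k , NI+Aσ x , (λ w → trans (L·NI+Aσ x w) (cong (_* x w) (sym m≡N²-N)))
    , subst (λ a → IsIntegral ((a / suc k) ℚ.- q)) (sym f·y≡a) integral

  ·-edgeVec : ∀ g p q → _·_ 𝒜 g (edgeVec 𝒜 p q) ≡ g p - ⟦ sign p q ⟧ * g q
  ·-edgeVec g p q = trans (∑≡sum (λ z → g z * edgeVec 𝒜 p q z)) (sum-*-δ-difference g p q ⟦ sign p q ⟧)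

  NI+Aσ-edgeVec : ∀ u v w → NI+Aσ (edgeVec 𝒜 u v) w ≡
                  + N * (δ u w - ⟦ sign u v ⟧ * δ v w) + (A w u - ⟦ sign u v ⟧ * A w v)
  NI+Aσ-edgeVec u v w = cong (_+_ (+ N * _)) (sum-*-δ-difference (A w) u v ⟦ sign u v ⟧)

  same-colour-edge-ends : ∀ {a b c d} → adj a b ≡ true → adj c d ≡ true → color c d ≡ color a b →
                          ¬ ((c ≡ a × d ≡ b) ⊎ (c ≡ b × d ≡ a)) →
                          ¬ a ≡ c × ¬ b ≡ c × ¬ a ≡ d × ¬ b ≡ d
  same-colour-edge-ends {a} {b} {c} {d} ab cd cd∼ab other =
      (λ { refl → other (inj₁ (refl , colour-unique a d b cd ab cd∼ab)) })
    , (λ { refl → other (inj₂ (refl , colour-unique b d a cd (adj-flip ab) (trans cd∼ab (color-sym a b ab)))) })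
    , (λ { refl → other (inj₂ (colour-unique a c b (adj-flip cd) ab (trans (sym (color-sym c a cd)) cd∼ab) , refl)) })
    , (λ { refl → other (inj₁ (colour-unique b c a (adj-flip cd) (adj-flip ab)
                                 (trans (sym (color-sym c b cd)) (trans cd∼ab (color-sym a b ab))) , refl)) })

  module _ {u v : Fin n} (uv : adj u v ≡ true) where
    private
      ε : ℤ
      ε = ⟦ sign u v ⟧
      f : ZV 𝒜
      f = NI+Aσ (edgeVec 𝒜 u v)

    f-at-u : f u ≡ + N - + 1
    f-at-u = begin
      f u                                             ≡⟨ NI+Aσ-edgeVec u v u ⟩
      + N * (δ u u - ε * δ v u) + (A u u - ε * A u v)
        ≡⟨ cong₂ (λ x y → + N * x + y) (cong₂ (λ x y → x - ε * y) (δ-refl u) (δ-≢ v≢u))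
                                        (cong₂ (λ x y → x - ε * y) (Aσ-nonedge (adj-irr u)) (Aσ-edge uv)) ⟩
      + N * (+ 1 - ε * + 0) + (+ 0 - ε * ε)           ≡⟨ simplify (+ N) ε ⟩
      + N - ε * ε                                     ≡⟨ cong (_-_ (+ N)) (⟦⟧-square (sign u v)) ⟩
      + N - + 1                                       ∎
      where
      v≢u : ¬ v ≡ u
      v≢u refl = not-¬ uv (adj-irr u)
      simplify : ∀ N ε → N * (+ 1 - ε * + 0) + (+ 0 - ε * ε) ≡ N - ε * ε
      simplify = solve-∀

    f-at-v : f v ≡ ε * (+ 1 - + N)
    f-at-v = begin
      f v                                             ≡⟨ NI+Aσ-edgeVec u v v ⟩
      + N * (δ u v - ε * δ v v) + (A v u - ε * A v v)
        ≡⟨ cong₂ (λ x y → + N * x + y) (cong₂ (λ x y → x - ε * y) (δ-≢ u≢v) (δ-refl v))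
                                        (cong₂ (λ x y → x - ε * y) (Aσ-edge-flip uv) (Aσ-nonedge (adj-irr v))) ⟩
      + N * (+ 0 - ε * + 1) + (ε - ε * + 0)           ≡⟨ simplify (+ N) ε ⟩
      ε * (+ 1 - + N)                                 ∎
      where
      u≢v : ¬ u ≡ v
      u≢v refl = not-¬ uv (adj-irr u)
      simplify : ∀ N ε → N * (+ 0 - ε * + 1) + (ε - ε * + 0) ≡ ε * (+ 1 - N)
      simplify = solve-∀

    f-off-edge : ∀ {p} → ¬ u ≡ p → ¬ v ≡ p → f p ≡ A p u - ε * A p v
    f-off-edge {p} u≢p v≢p = begin
      f p                                             ≡⟨ NI+Aσ-edgeVec u v p ⟩
      + N * (δ u p - ε * δ v p) + (A p u - ε * A p v)
        ≡⟨ cong (λ x → + N * x + (A p u - ε * A p v)) (cong₂ (λ x y → x - ε * y) (δ-≢ u≢p) (δ-≢ v≢p)) ⟩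
      + N * (+ 0 - ε * + 0) + (A p u - ε * A p v)     ≡⟨ simplify (+ N) ε (A p u - ε * A p v) ⟩
      A p u - ε * A p v                               ∎
      where
      simplify : ∀ N ε y → N * (+ 0 - ε * + 0) + y ≡ y
      simplify = solve-∀

    edgeVec-self-pairing : _·_ 𝒜 f (edgeVec 𝒜 u v) ≡ + 2 * + N - + 2
    edgeVec-self-pairing = begin
      _·_ 𝒜 f (edgeVec 𝒜 u v)             ≡⟨ ·-edgeVec f u v ⟩
      f u - ε * f v                       ≡⟨ cong₂ (λ x y → x - ε * y) f-at-u f-at-v ⟩
      (+ N - + 1) - ε * (ε * (+ 1 - + N)) ≡⟨ cong (_-_ (+ N - + 1)) (⟦⟧-*-⟦⟧ (sign u v) (+ 1 - + N)) ⟩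
      (+ N - + 1) - (+ 1 - + N)           ≡⟨ collect (+ N) ⟩
      + 2 * + N - + 2                     ∎
      where
      collect : ∀ N → (N - + 1) - (+ 1 - N) ≡ + 2 * N - + 2
      collect = solve-∀

    edgeVec-other-pairing : ∀ {p q} → adj p q ≡ true → color p q ≡ color u v →
                            ¬ ((p ≡ u × q ≡ v) ⊎ (p ≡ v × q ≡ u)) → _·_ 𝒜 f (edgeVec 𝒜 p q) ≡ + 0
    edgeVec-other-pairing {p} {q} pq pq∼uv other = begin
      _·_ 𝒜 f (edgeVec 𝒜 p q)   ≡⟨ ·-edgeVec f p q ⟩
      f p - ε′ * f q            ≡⟨ cong₂ (λ x y → x - ε′ * y) (f-off-edge u≢p v≢p) (f-off-edge u≢q v≢q) ⟩
      (A p u - ε * A p v) - ε′ * (A q u - ε * A q v)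
                                ≡⟨ cross-terms-cancel ε ε′ _ _ _ _ (⟦⟧-square (sign u v)) εApu εApv ⟩
      + 0                       ∎
      where
      ε′ = ⟦ sign p q ⟧
      ends = same-colour-edge-ends uv pq pq∼uv other
      u≢p = proj₁ ends
      v≢p = proj₁ (proj₂ ends)
      u≢q = proj₁ (proj₂ (proj₂ ends))
      v≢q = proj₂ (proj₂ (proj₂ ends))
      εApu : ε * A p u ≡ - (ε′ * A q v)
      εApu = same-colour-edges-Aσ uv pq pq∼uv u≢q v≢p
      εApv : ε * A p v ≡ - (ε′ * A q u)
      εApv = trans (cong (λ s → ⟦ s ⟧ * A p v) (sign-sym u v uv))
                   (same-colour-edges-Aσ (adj-flip uv) pq (trans pq∼uv (color-sym u v uv)) v≢q u≢p)

N*[N-1]≡N²-N : ∀ N₁ → + (suc N₁ ℕ.* N₁) ≡ + suc N₁ * + suc N₁ - + suc N₁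
N*[N-1]≡N²-N N₁ = trans (ℤP.pos-* (suc N₁) N₁) (factor (+ N₁))
  where
  factor : ∀ a → (+ 1 + a) * a ≡ (+ 1 + a) * (+ 1 + a) - (+ 1 + a)
  factor = solve-∀

[2N-2]/[N²-N]≡2/N : ∀ N₁ k → + suc k ≡ + suc N₁ * + suc N₁ - + suc N₁ →
                    (+ 2 * + suc N₁ - + 2) / suc k ≡ + 2 / suc N₁
[2N-2]/[N²-N]≡2/N N₁ k m≡N²-N = ℚP.fromℚᵘ-cong {mkℚᵘ (+ 2 * + suc N₁ - + 2) k} {mkℚᵘ (+ 2) N₁}
  (*≡* (trans (factor (+ suc N₁)) (cong (_*_ (+ 2)) (sym m≡N²-N))))
  where
  factor : ∀ a → (+ 2 * a - + 2) * a ≡ + 2 * (a * a - a)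
  factor = solve-∀

IsIntegral-≡ : ∀ {p q} → p ≡ q → IsIntegral (p ℚ.- q)
IsIntegral-≡ {q = q} refl = + 0 , ℚP.+-inverseʳ q

-- cross-multiplying, 2 / N ≡ k / 1 says 2 ≡ k * N
2/N-not-integral : ∀ {N} .{{_ : NonZero N}} → 3 ≤ N → ¬ IsIntegral (+ 2 / N)
2/N-not-integral {suc (suc (suc M))} (s≤s (s≤s (s≤s _))) (k , 2/N≡k)
  with ℚP.fromℚᵘ-injective {mkℚᵘ (+ 2) (suc (suc M))} {mkℚᵘ k 0} 2/N≡k
2/N-not-integral _ (+ zero   , _) | *≡* ()
2/N-not-integral _ (+ suc _  , _) | *≡* ()
2/N-not-integral _ (-[1+ _ ] , _) | *≡* ()

proposition3p2 : (N : ℕ) → .{{_ : NonZero N}} → 3 ≤ N → (𝒜 : Adinkra N) →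
    ∀ u v → Adinkra.adj 𝒜 u v ≡ true →
      PairingEq 𝒜 (edgeVec 𝒜 u v) (edgeVec 𝒜 u v) ((+ 2) / N)
      × ¬ IsIntegral ((+ 2) / N)
      × (∀ x y → Adinkra.adj 𝒜 x y ≡ true →
           Adinkra.color 𝒜 x y ≡ Adinkra.color 𝒜 u v →
           ¬ ((x ≡ u × y ≡ v) ⊎ (x ≡ v × y ≡ u)) →
           PairingEq 𝒜 (edgeVec 𝒜 u v) (edgeVec 𝒜 x y) 0ℚ)
proposition3p2 N@(suc N₁@(suc (suc M))) 3≤N@(s≤s (s≤s (s≤s _))) 𝒜 u v uv =
    pairing-via-NI+Aσ 𝒜 k m≡N²-N (edgeVec 𝒜 u v) (edgeVec 𝒜 u v) (+ 2 / N) (edgeVec-self-pairing 𝒜 uv)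
      (IsIntegral-≡ ([2N-2]/[N²-N]≡2/N N₁ k m≡N²-N))
  , 2/N-not-integral 3≤N
  , λ x y xy xy∼uv other →
      pairing-via-NI+Aσ 𝒜 k m≡N²-N (edgeVec 𝒜 u v) (edgeVec 𝒜 x y) 0ℚ (edgeVec-other-pairing 𝒜 uv xy xy∼uv other)
        (IsIntegral-≡ (ℚP.0/n≡0 (suc k)))
  where
  -- suc k reduces to N * N₁ = N(N − 1)
  k : ℕ
  k = suc M ℕ.+ N₁ ℕ.* N₁
  m≡N²-N : + suc k ≡ + N * + N - + N
  m≡N²-N = N*[N-1]≡N²-N N₁
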